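{- Let $k$ be an odd positive integer and $n$ a positive integer. Then $v(n) = v\big(\binom{n}{k}\big)$ if and only if one of the following two conditions is satisfied: (1) $n$ is odd and $b_i(n) \geq b_i(k)$ for all $i$; (2) $n$ is even, $b_i(n) \geq b_i(k)$ for all $i > v(n)$, and $b_{v(n)}(k) = 0$.
   Context: $v(\cdot)$ denotes the $2$-adic valuation (with $v(0)=\infty$). For a nonnegative integer $a$, $b_i(a) \in \{0,1\}$ denotes the $i$-th binary digit of $a$, so that $a = \sum_{i\geq0} b_i(a) 2^i$. -}

module Defs where

open import Data.Nat using (ℕ; zero; suc; _^_; _/_; _%_; _+_)
open import Data.Nat.Divisibility using (_∣_)
open import Data.Nat.Properties using ()
open import Relation.Nullary using (¬_)
open import Data.Product using (_×_)

-- i-th binary digit of a : b i a = ⌊a / 2^i⌋ mod 2  (∈ {0,1}),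
-- computed by shifting right i times.
b : ℕ → ℕ → ℕ
b zero a = a % 2
b (suc i) a = b i (a / 2)

-- "v(m) = e": the 2-adic valuation of m equals the finite value e.
-- (v(0) = ∞, so IsVal 0 e never holds.)
IsVal : ℕ → ℕ → Set
IsVal m e = (2 ^ e ∣ m) × ¬ (2 ^ suc e ∣ m)

-- v(x) = v(y) as extended naturals: they have the same finite valuation,
-- or both are ∞.
SameVal : ℕ → ℕ → Set
SameVal x y = ∀ e → (IsVal x e → IsVal y e) × (IsVal y e → IsVal x e)

{-# OPTIONS --safe #-}

-- Write k = 1 + 2c and n = 1 + m.  The absorption identity k · C(n, k) = n · C(m, 2c)
-- with k odd gives v(C(n, k)) = v(n) + v(C(m, 2c)), so v(n) = v(C(n, k)) exactly when
-- C(m, 2c) is odd, i.e. (Lucas' theorem mod 2) when every binary digit of 2c is at most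
-- the corresponding digit of m.  For n odd this is condition (1).  For n even with
-- v(n) = w, the digits of m = n - 1 are 1 below position w, 0 at w and those of n above
-- w, which turns the digit comparison into condition (2).

module Submission where

open import Defs
open import Data.Empty using (⊥-elim)
open import Data.Nat
open import Data.Nat.Combinatorics using (_C_; nC1≡n) renaming (nCk+nC[k+1]≡[n+1]C[k+1] to pascal)
open import Data.Nat.DivMod using (m*n%n≡0; [m+kn]%n≡m%n; %-distribˡ-+; m%n<n; m*n/n≡m; +-distrib-/)
open import Data.Nat.Divisibility
open import Data.Nat.Induction using (<-rec)
open import Data.Nat.Primality using (prime[2]; euclidsLemma)
open import Data.Nat.Properties
open import Data.Nat.Solver using (module +-*-Solver)
open import Data.Product using (_×_; _,_; proj₁; proj₂; ∃; map)
open import Data.Sum using (_⊎_; inj₁; inj₂)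
open import Function.Base using (_∘_)
open import Function.Bundles using (_⇔_; mk⇔; module Equivalence)
open import Function.Properties.Equivalence using (⇔-setoid) renaming (sym to ⇔-sym; trans to ⇔-trans)
open import Level using (0ℓ)
open import Relation.Binary.Definitions using (tri<; tri≈; tri>)
open import Relation.Binary.PropositionalEquality
open import Relation.Nullary using (¬_)

open Equivalence using (to; from)

data EvenOdd : ℕ → Set where
  even : ∀ h → EvenOdd (h * 2)
  odd  : ∀ h → EvenOdd (1 + h * 2)

evenOdd : ∀ n → EvenOdd n
evenOdd zero = even 0
evenOdd (suc n) with evenOdd n
... | even h = odd h
... | odd h  = even (suc h)

binary-induction : (P : ℕ → Set) → P 0 →
                   (∀ h → P h → P (h * 2)) → (∀ h → P h → P (1 + h * 2)) →
                   ∀ n → P n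
binary-induction P P0 P-even P-odd = <-rec P step
  where
  step : ∀ n → (∀ {m} → m < n → P m) → P n
  step n rec with evenOdd n
  ... | even zero    = P0
  ... | even (suc h) = P-even (suc h) (rec (m<m*n (suc h) 2 ≤-refl))
  ... | odd h        = P-odd h (rec (s≤s (m≤m*n h 2)))

h*2%2≡0 : ∀ h → (h * 2) % 2 ≡ 0
h*2%2≡0 h = m*n%n≡0 h 2

[1+h*2]%2≡1 : ∀ h → (1 + h * 2) % 2 ≡ 1
[1+h*2]%2≡1 h = [m+kn]%n≡m%n 1 h 2

[1+h*2]/2≡h : ∀ h → (1 + h * 2) / 2 ≡ h
[1+h*2]/2≡h h =
  trans (+-distrib-/ 1 (h * 2) (subst (λ r → 1 + r < 2) (sym (h*2%2≡0 h)) ≤-refl)) (m*n/n≡m h 2)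

b-suc-even : ∀ i h → b (suc i) (h * 2) ≡ b i h
b-suc-even i h = cong (b i) (m*n/n≡m h 2)

b-suc-odd : ∀ i h → b (suc i) (1 + h * 2) ≡ b i h
b-suc-odd i h = cong (b i) ([1+h*2]/2≡h h)

b≤1 : ∀ i n → b i n ≤ 1
b≤1 zero    n = ≤-pred (m%n<n n 2)
b≤1 (suc i) n = b≤1 i (n / 2)

infix 4 _≼_

_≼_ : ℕ → ℕ → Set
k ≼ n = ∀ i → b i k ≤ b i n

≼-halves : ∀ {k n c a} → b 0 k ≤ b 0 n → k / 2 ≡ c → n / 2 ≡ a → k ≼ n ⇔ c ≼ a
≼-halves b₀ refl refl = mk⇔
  (λ k≼n i → k≼n (suc i))
  (λ { c≼a zero → b₀ ; c≼a (suc i) → c≼a i })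

c*2≼a*2⇔c≼a : ∀ c a → c * 2 ≼ a * 2 ⇔ c ≼ a
c*2≼a*2⇔c≼a c a =
  ≼-halves (≤-reflexive (trans (h*2%2≡0 c) (sym (h*2%2≡0 a)))) (m*n/n≡m c 2) (m*n/n≡m a 2)

c*2≼1+a*2⇔c≼a : ∀ c a → c * 2 ≼ 1 + a * 2 ⇔ c ≼ a
c*2≼1+a*2⇔c≼a c a =
  ≼-halves (subst (_≤ (1 + a * 2) % 2) (sym (h*2%2≡0 c)) z≤n) (m*n/n≡m c 2) ([1+h*2]/2≡h a)

1+c*2≼1+a*2⇔c≼a : ∀ c a → 1 + c * 2 ≼ 1 + a * 2 ⇔ c ≼ a
1+c*2≼1+a*2⇔c≼a c a =
  ≼-halves (≤-reflexive (trans ([1+h*2]%2≡1 c) (sym ([1+h*2]%2≡1 a))))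
           ([1+h*2]/2≡h c) ([1+h*2]/2≡h a)

1+c*2⋠a*2 : ∀ c a → ¬ (1 + c * 2 ≼ a * 2)
1+c*2⋠a*2 c a k≼n with subst₂ _≤_ ([1+h*2]%2≡1 c) (h*2%2≡0 a) (k≼n 0)
... | ()

≼0⇒≡0 : ∀ k → k ≼ 0 → k ≡ 0
≼0⇒≡0 = binary-induction (λ k → k ≼ 0 → k ≡ 0) (λ _ → refl)
  (λ h ih h*2≼0 → cong (_* 2) (ih (to (c*2≼a*2⇔c≼a h 0) h*2≼0)))
  (λ h _ k≼0 → ⊥-elim (1+c*2⋠a*2 h 0 k≼0))

%2-+-cong : ∀ x y x′ y′ → x % 2 ≡ x′ % 2 → y % 2 ≡ y′ % 2 → (x + y) % 2 ≡ (x′ + y′) % 2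
%2-+-cong x y x′ y′ x≡x′ y≡y′ = begin
  (x + y) % 2           ≡⟨ %-distribˡ-+ x y 2 ⟩
  (x % 2 + y % 2) % 2   ≡⟨ cong₂ (λ u v → (u + v) % 2) x≡x′ y≡y′ ⟩
  (x′ % 2 + y′ % 2) % 2 ≡⟨ %-distribˡ-+ x′ y′ 2 ⟨
  (x′ + y′) % 2         ∎
  where open ≡-Reasoning

[2+n]C[2+k]%2 : ∀ n k → ((2 + n) C (2 + k)) % 2 ≡ (n C k + n C (2 + k)) % 2
[2+n]C[2+k]%2 n k = begin
  ((2 + n) C (2 + k)) % 2                     ≡⟨ cong (_% 2) (pascal (1 + n) (1 + k)) ⟨
  ((1 + n) C (1 + k) + (1 + n) C (2 + k)) % 2 ≡⟨ cong₂ (λ u v → (u + v) % 2) (pascal n k) (pascal n (1 + k)) ⟨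
  (x + y + (y + z)) % 2                       ≡⟨ cong (_% 2) (regroup x y z) ⟩
  (x + z + y * 2) % 2                         ≡⟨ [m+kn]%n≡m%n (x + z) y 2 ⟩
  (x + z) % 2                                 ∎
  where
  open ≡-Reasoning
  x = n C k
  y = n C (1 + k)
  z = n C (2 + k)
  regroup : ∀ x y z → x + y + (y + z) ≡ x + z + y * 2
  regroup = +-*-Solver.solve 3 (λ x y z → x :+ y :+ (y :+ z) := x :+ z :+ y :* con 2) refl
    where open +-*-Solver

[a*2]C[c*2]%2≡aCc%2 : ∀ a c → ((a * 2) C (c * 2)) % 2 ≡ (a C c) % 2
[a*2]C[c*2]%2≡aCc%2 zero    zero    = refl
[a*2]C[c*2]%2≡aCc%2 zero    (suc c) = refl
[a*2]C[c*2]%2≡aCc%2 (suc a) zero    = refl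
[a*2]C[c*2]%2≡aCc%2 (suc a) (suc c) = begin
  ((2 + a * 2) C (2 + c * 2)) % 2 ≡⟨ [2+n]C[2+k]%2 (a * 2) (c * 2) ⟩
  (X + Y) % 2                     ≡⟨ %2-+-cong X Y (a C c) (a C suc c) ([a*2]C[c*2]%2≡aCc%2 a c)
                                                                       ([a*2]C[c*2]%2≡aCc%2 a (suc c)) ⟩
  (a C c + a C suc c) % 2         ≡⟨ cong (_% 2) (pascal a c) ⟩
  (suc a C suc c) % 2             ∎
  where
  open ≡-Reasoning
  X = (a * 2) C (c * 2)
  Y = (a * 2) C (2 + c * 2)

[a*2]C[1+c*2]%2≡0 : ∀ a c → ((a * 2) C (1 + c * 2)) % 2 ≡ 0
[a*2]C[1+c*2]%2≡0 zero    c       = refl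
[a*2]C[1+c*2]%2≡0 (suc a) zero    = trans (cong (_% 2) (nC1≡n (suc a * 2))) (h*2%2≡0 (suc a))
[a*2]C[1+c*2]%2≡0 (suc a) (suc c) = begin
  ((2 + a * 2) C (3 + c * 2)) % 2 ≡⟨ [2+n]C[2+k]%2 (a * 2) (1 + c * 2) ⟩
  (X + Y) % 2                     ≡⟨ %2-+-cong X Y 0 0 ([a*2]C[1+c*2]%2≡0 a c)
                                                       ([a*2]C[1+c*2]%2≡0 a (suc c)) ⟩
  0                               ∎
  where
  open ≡-Reasoning
  X = (a * 2) C (1 + c * 2)
  Y = (a * 2) C (3 + c * 2)

[1+a*2]C[c*2]%2≡aCc%2 : ∀ a c → ((1 + a * 2) C (c * 2)) % 2 ≡ (a C c) % 2
[1+a*2]C[c*2]%2≡aCc%2 a zero    = refl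
[1+a*2]C[c*2]%2≡aCc%2 a (suc c) = begin
  ((1 + a * 2) C (2 + c * 2)) % 2 ≡⟨ cong (_% 2) (pascal (a * 2) (1 + c * 2)) ⟨
  (X + Y) % 2                     ≡⟨ %2-+-cong X Y 0 (a C suc c) ([a*2]C[1+c*2]%2≡0 a c)
                                                                 ([a*2]C[c*2]%2≡aCc%2 a (suc c)) ⟩
  (a C suc c) % 2                 ∎
  where
  open ≡-Reasoning
  X = (a * 2) C (1 + c * 2)
  Y = (a * 2) C (2 + c * 2)

[1+a*2]C[1+c*2]%2≡aCc%2 : ∀ a c → ((1 + a * 2) C (1 + c * 2)) % 2 ≡ (a C c) % 2
[1+a*2]C[1+c*2]%2≡aCc%2 a c = begin
  ((1 + a * 2) C (1 + c * 2)) % 2 ≡⟨ cong (_% 2) (pascal (a * 2) (c * 2)) ⟨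
  (X + Y) % 2                     ≡⟨ %2-+-cong X Y (a C c) 0 ([a*2]C[c*2]%2≡aCc%2 a c)
                                                             ([a*2]C[1+c*2]%2≡0 a c) ⟩
  (a C c + 0) % 2                 ≡⟨ cong (_% 2) (+-identityʳ (a C c)) ⟩
  (a C c) % 2                     ∎
  where
  open ≡-Reasoning
  X = (a * 2) C (c * 2)
  Y = (a * 2) C (1 + c * 2)

nCk%2≡1⇔k≼n : ∀ n k → (n C k) % 2 ≡ 1 ⇔ k ≼ n
nCk%2≡1⇔k≼n = binary-induction (λ n → ∀ k → (n C k) % 2 ≡ 1 ⇔ k ≼ n) base even-step odd-step
  where
  reduce : ∀ {n k a c} → (n C k) % 2 ≡ (a C c) % 2 → (k ≼ n ⇔ c ≼ a) →
           (a C c) % 2 ≡ 1 ⇔ c ≼ a → (n C k) % 2 ≡ 1 ⇔ k ≼ n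
  reduce C≡ ≼⇔ ih = ⇔-trans (mk⇔ (trans (sym C≡)) (trans C≡)) (⇔-trans ih (⇔-sym ≼⇔))

  base : ∀ k → (0 C k) % 2 ≡ 1 ⇔ k ≼ 0
  base zero    = mk⇔ (λ _ _ → ≤-refl) (λ _ → refl)
  base (suc k) = mk⇔ (λ ()) (λ k≼0 → ⊥-elim (1+n≢0 (≼0⇒≡0 (suc k) k≼0)))

  even-step : ∀ a → (∀ c → (a C c) % 2 ≡ 1 ⇔ c ≼ a) →
              ∀ k → ((a * 2) C k) % 2 ≡ 1 ⇔ k ≼ a * 2
  even-step a ih k with evenOdd k
  ... | even c = reduce ([a*2]C[c*2]%2≡aCc%2 a c) (c*2≼a*2⇔c≼a c a) (ih c)
  ... | odd c  = mk⇔ (λ odd → ⊥-elim (0≢1+n (trans (sym ([a*2]C[1+c*2]%2≡0 a c)) odd)))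
                     (⊥-elim ∘ 1+c*2⋠a*2 c a)

  odd-step : ∀ a → (∀ c → (a C c) % 2 ≡ 1 ⇔ c ≼ a) →
             ∀ k → ((1 + a * 2) C k) % 2 ≡ 1 ⇔ k ≼ 1 + a * 2
  odd-step a ih k with evenOdd k
  ... | even c = reduce ([1+a*2]C[c*2]%2≡aCc%2 a c) (c*2≼1+a*2⇔c≼a c a) (ih c)
  ... | odd c  = reduce ([1+a*2]C[1+c*2]%2≡aCc%2 a c) (1+c*2≼1+a*2⇔c≼a c a) (ih c)

[k+1]*[n+1]C[k+1]≡[n+1]*nCk : ∀ n k → suc k * (suc n C suc k) ≡ suc n * (n C k)
[k+1]*[n+1]C[k+1]≡[n+1]*nCk zero    zero    = refl
[k+1]*[n+1]C[k+1]≡[n+1]*nCk zero    (suc k) = *-zeroʳ (2 + k)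
[k+1]*[n+1]C[k+1]≡[n+1]*nCk (suc n) zero    =
  trans (*-identityˡ _) (trans (nC1≡n (2 + n)) (sym (*-identityʳ (2 + n))))
[k+1]*[n+1]C[k+1]≡[n+1]*nCk (suc n) (suc k) = begin
  (2 + k) * ((2 + n) C (2 + k))                   ≡⟨ cong ((2 + k) *_) (pascal (1 + n) (1 + k)) ⟨
  (2 + k) * (X + Y)                               ≡⟨ *-distribˡ-+ (2 + k) X Y ⟩
  X + (1 + k) * X + (2 + k) * Y                   ≡⟨ cong₂ (λ u v → X + u + v) (absorb n k) (absorb n (suc k)) ⟩
  X + (1 + n) * (n C k) + (1 + n) * (n C suc k)   ≡⟨ +-assoc X _ _ ⟩
  X + ((1 + n) * (n C k) + (1 + n) * (n C suc k)) ≡⟨ cong (X +_) (*-distribˡ-+ (1 + n) (n C k) (n C suc k)) ⟨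
  X + (1 + n) * (n C k + n C suc k)               ≡⟨ cong (λ z → X + (1 + n) * z) (pascal n k) ⟩
  (2 + n) * X                                     ∎
  where
  open ≡-Reasoning
  absorb = [k+1]*[n+1]C[k+1]≡[n+1]*nCk
  X = (1 + n) C (1 + k)
  Y = (1 + n) C (2 + k)

odd⇒2∤ : ∀ {u} → u % 2 ≡ 1 → ¬ 2 ∣ u
odd⇒2∤ {u} u-odd 2∣u = 0≢1+n (trans (sym (n∣m⇒m%n≡0 u 2 2∣u)) u-odd)

2^[1+e]∣h*2⇔2^e∣h : ∀ e h → 2 ^ suc e ∣ h * 2 ⇔ 2 ^ e ∣ h
2^[1+e]∣h*2⇔2^e∣h e h = mk⇔
  (λ d → *-cancelˡ-∣ 2 (subst (2 ^ suc e ∣_) (*-comm h 2) d))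
  (λ d → subst (2 ^ suc e ∣_) (*-comm 2 h) (*-monoʳ-∣ 2 d))

2^e∣u*x⇒2^e∣x : ∀ e u x → u % 2 ≡ 1 → 2 ^ e ∣ u * x → 2 ^ e ∣ x
2^e∣u*x⇒2^e∣x zero    u x _     _ = 1∣ x
2^e∣u*x⇒2^e∣x (suc e) u x u-odd d with euclidsLemma u x prime[2] (∣-trans (m∣m*n (2 ^ e)) d)
... | inj₁ 2∣u              = ⊥-elim (odd⇒2∤ u-odd 2∣u)
... | inj₂ (divides h refl) = from (2^[1+e]∣h*2⇔2^e∣h e h) (2^e∣u*x⇒2^e∣x e u h u-odd 2^e∣u*h)
  where
  2^e∣u*h : 2 ^ e ∣ u * h
  2^e∣u*h = to (2^[1+e]∣h*2⇔2^e∣h e (u * h)) (subst (2 ^ suc e ∣_) (sym (*-assoc u h 2)) d)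

IsVal-*-odd : ∀ u x e → u % 2 ≡ 1 → IsVal (u * x) e ⇔ IsVal x e
IsVal-*-odd u x e u-odd = mk⇔
  (λ { (d , ∤) → 2^e∣u*x⇒2^e∣x e u x u-odd d , ∤ ∘ ∣n⇒∣m*n u })
  (λ { (d , ∤) → ∣n⇒∣m*n u d , ∤ ∘ 2^e∣u*x⇒2^e∣x (suc e) u x u-odd })

IsVal[h*2][1+w]⇔IsVal[h]w : ∀ h w → IsVal (h * 2) (suc w) ⇔ IsVal h w
IsVal[h*2][1+w]⇔IsVal[h]w h w = mk⇔
  (λ { (d , ∤) → to (2^[1+e]∣h*2⇔2^e∣h w h) d , ∤ ∘ from (2^[1+e]∣h*2⇔2^e∣h (suc w) h) })
  (λ { (d , ∤) → from (2^[1+e]∣h*2⇔2^e∣h w h) d , ∤ ∘ to (2^[1+e]∣h*2⇔2^e∣h (suc w) h) })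

IsVal[1+h*2]0 : ∀ h → IsVal (1 + h * 2) 0
IsVal[1+h*2]0 h = 1∣ _ , odd⇒2∤ ([1+h*2]%2≡1 h)

¬IsVal[h*2]0 : ∀ h → ¬ IsVal (h * 2) 0
¬IsVal[h*2]0 h (_ , ∤) = ∤ (divides h refl)

¬IsVal[1+h*2][1+w] : ∀ h w → ¬ IsVal (1 + h * 2) (suc w)
¬IsVal[1+h*2][1+w] h w (d , _) = odd⇒2∤ ([1+h*2]%2≡1 h) (∣-trans (m∣m*n (2 ^ w)) d)

valuation : ∀ n → 1 ≤ n → ∃ (IsVal n)
valuation = binary-induction (λ n → 1 ≤ n → ∃ (IsVal n)) (λ ()) even-step odd-step
  where
  even-step : ∀ h → (1 ≤ h → ∃ (IsVal h)) → 1 ≤ h * 2 → ∃ (IsVal (h * 2))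
  even-step (suc h) ih _ =
    map suc (λ {w} → from (IsVal[h*2][1+w]⇔IsVal[h]w (suc h) w)) (ih (s≤s z≤n))
  odd-step : ∀ h → (1 ≤ h → ∃ (IsVal h)) → 1 ≤ 1 + h * 2 → ∃ (IsVal (1 + h * 2))
  odd-step h _ _ = 0 , IsVal[1+h*2]0 h

SameVal-*-odd : ∀ u x y → u % 2 ≡ 1 → SameVal x (u * y) ⇔ SameVal x y
SameVal-*-odd u x y u-odd = mk⇔
  (λ same e → map (to (iv e) ∘_) (_∘ from (iv e)) (same e))
  (λ same e → map (from (iv e) ∘_) (_∘ to (iv e)) (same e))
  where
  iv : ∀ e → IsVal (u * y) e ⇔ IsVal y e
  iv e = IsVal-*-odd u y e u-odd

SameVal[n][n*y]⇔y%2≡1 : ∀ n y → 1 ≤ n → SameVal n (n * y) ⇔ y % 2 ≡ 1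
SameVal[n][n*y]⇔y%2≡1 n y 1≤n = mk⇔ forward backward
  where
  forward : SameVal n (n * y) → y % 2 ≡ 1
  forward same with valuation n 1≤n | evenOdd y
  ... | _ , _ | odd h  = [1+h*2]%2≡1 h
  ... | w , v | even h = ⊥-elim (proj₂ (proj₁ (same w) v) 2^[1+w]∣n*[h*2])
    where
    2^[1+w]∣n*[h*2] : 2 ^ suc w ∣ n * (h * 2)
    2^[1+w]∣n*[h*2] =
      subst (_∣ n * (h * 2)) (*-comm (2 ^ w) 2) (*-pres-∣ (proj₁ v) (divides h refl))
  backward : y % 2 ≡ 1 → SameVal n (n * y)
  backward y-odd e = from iv , to iv
    where
    iv : IsVal (n * y) e ⇔ IsVal n e
    iv = subst (λ m → IsVal m e ⇔ IsVal n e) (*-comm y n) (IsVal-*-odd y n e y-odd)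

record PredecessorBits (m w : ℕ) : Set where
  field
    below : ∀ i → i < w → b i m ≡ 1
    at    : b w m ≡ 0
    above : ∀ i → w < i → b i m ≡ b i (suc m)

predecessorBits : ∀ m w → IsVal (suc m) w → PredecessorBits m w
predecessorBits m w v with evenOdd m | w
... | even d | zero = record
  { below = λ _ ()
  ; at    = h*2%2≡0 d
  ; above = λ { (suc i) _ → trans (b-suc-even i d) (sym (b-suc-odd i d)) }
  }
... | odd d  | zero  = ⊥-elim (¬IsVal[h*2]0 (suc d) v)
... | even d | suc w = ⊥-elim (¬IsVal[1+h*2][1+w] d w v)
... | odd d  | suc w = record
  { below = λ { zero _ → [1+h*2]%2≡1 d
              ; (suc i) (s≤s i<w) → trans (b-suc-odd i d) (below i i<w) }
  ; at    = trans (b-suc-odd w d) at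
  ; above = λ { (suc i) (s≤s w<i) →
                trans (b-suc-odd i d) (trans (above i w<i) (sym (b-suc-even i (suc d)))) }
  }
  where open PredecessorBits (predecessorBits d w (to (IsVal[h*2][1+w]⇔IsVal[h]w (suc d) w) v))

≼-pred⇔ : ∀ c m w → IsVal (suc m) w →
          c ≼ m ⇔ ((∀ i → w < i → b i c ≤ b i (suc m)) × b w c ≡ 0)
≼-pred⇔ c m w v = mk⇔ forward backward
  where
  open PredecessorBits (predecessorBits m w v)
  forward : c ≼ m → (∀ i → w < i → b i c ≤ b i (suc m)) × b w c ≡ 0
  forward c≼m = (λ i w<i → subst (b i c ≤_) (above i w<i) (c≼m i))
              , n≤0⇒n≡0 (subst (b w c ≤_) at (c≼m w))
  backward : (∀ i → w < i → b i c ≤ b i (suc m)) × b w c ≡ 0 → c ≼ m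
  backward (c≤above , c-at) i with <-cmp i w
  ... | tri< i<w _ _ = subst (b i c ≤_) (sym (below i i<w)) (b≤1 i c)
  ... | tri≈ _ refl _ = subst (_≤ b i m) (sym c-at) z≤n
  ... | tri> _ _ w<i = subst (b i c ≤_) (sym (above i w<i)) (c≤above i w<i)

DigitCondition : ℕ → ℕ → Set
DigitCondition k n =
  (n % 2 ≡ 1 × k ≼ n) ⊎
  (n % 2 ≡ 0 × (∀ w → IsVal n w → (∀ i → w < i → b i k ≤ b i n) × b w k ≡ 0))

c*2≼m⇔DigitCondition : ∀ c m → c * 2 ≼ m ⇔ DigitCondition (1 + c * 2) (suc m)
c*2≼m⇔DigitCondition c m with evenOdd m
... | even a = mk⇔
  (λ c*2≼m → inj₁ ([1+h*2]%2≡1 a , to c*2≼m⇔k≼n c*2≼m))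
  λ { (inj₁ (_ , k≼n))    → from c*2≼m⇔k≼n k≼n
    ; (inj₂ (n-even , _)) → ⊥-elim (0≢1+n (trans (sym n-even) ([1+h*2]%2≡1 a))) }
  where
  c*2≼m⇔k≼n : c * 2 ≼ a * 2 ⇔ 1 + c * 2 ≼ 1 + a * 2
  c*2≼m⇔k≼n = ⇔-trans (c*2≼a*2⇔c≼a c a) (⇔-sym (1+c*2≼1+a*2⇔c≼a c a))
... | odd a = mk⇔
  (λ c*2≼m → inj₂ (h*2%2≡0 (suc a) , λ w v → to (≼-pred⇔ k m w v) (to c*2≼m⇔k≼m c*2≼m)))
  λ { (inj₁ (n-odd , _))     → ⊥-elim (0≢1+n (trans (sym (h*2%2≡0 (suc a))) n-odd))
    ; (inj₂ (_ , conditions)) → let (w , v) = valuation (suc m) (s≤s z≤n)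
                                in from c*2≼m⇔k≼m (from (≼-pred⇔ k m w v) (conditions w v)) }
  where
  k = 1 + c * 2
  c*2≼m⇔k≼m : c * 2 ≼ 1 + a * 2 ⇔ k ≼ 1 + a * 2
  c*2≼m⇔k≼m = ⇔-trans (c*2≼1+a*2⇔c≼a c a) (⇔-sym (1+c*2≼1+a*2⇔c≼a c a))

lemma5p3 : (k n : ℕ) → k % 2 ≡ 1 → 1 ≤ n →
    SameVal n (n C k) ⇔
      ((n % 2 ≡ 1 × (∀ i → b i k ≤ b i n))
      ⊎ (n % 2 ≡ 0 × (∀ w → IsVal n w →
            (∀ i → w < i → b i k ≤ b i n) × b w k ≡ 0)))
lemma5p3 k (suc m) k-odd _ with evenOdd k
... | even c = ⊥-elim (0≢1+n (trans (sym (h*2%2≡0 c)) k-odd))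
... | odd c  = begin
  SameVal n (n C k)              ≈⟨ SameVal-*-odd k n (n C k) k-odd ⟨
  SameVal n (k * (n C k))        ≡⟨ cong (SameVal n) ([k+1]*[n+1]C[k+1]≡[n+1]*nCk m (c * 2)) ⟩
  SameVal n (n * (m C (c * 2)))  ≈⟨ SameVal[n][n*y]⇔y%2≡1 n (m C (c * 2)) (s≤s z≤n) ⟩
  (m C (c * 2)) % 2 ≡ 1          ≈⟨ nCk%2≡1⇔k≼n m (c * 2) ⟩
  c * 2 ≼ m                      ≈⟨ c*2≼m⇔DigitCondition c m ⟩
  DigitCondition k n             ∎
  where
  open import Relation.Binary.Reasoning.Setoid (⇔-setoid 0ℓ)
  n = suc m
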